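{- Let $G$ be a kinky benzenoid system with hexagons $h_1,\dots,h_n$ ordered as described in the context, and let $\ell(M)$ be a maximal element of $(\mathcal{L}(G),\leq)$, where $M$ is a perfect matching of $G$. Then there exists a maximal resonant set $S$ of $G$ such that $b(S)=\ell(M)$.
   Context: A benzenoid system is a 2-connected plane graph in which every interior face is a hexagon. Two hexagons are adjacent if they share an edge; a hexagon is terminal if it is adjacent to exactly one other hexagon. $G$ is catacondensed if every vertex belongs to at most two hexagons; a hexagon adjacent to exactly two others has two vertices of degree two, and is linearly connected if these are non-adjacent. A kinky benzenoid system is a catacondensed benzenoid system with no linearly connected hexagons. The inner dual $T$ of $G$ (vertices = hexagons, edges = adjacent pairs) is a tree. The hexagons are numbered $h_1,\dots,h_n$ by a depth-first or breadth-first search on $T$ starting at a leaf $h_1$ of $T$, so that $h_i$ is a predecessor (ancestor) of $h_j$ in $T$ rooted at $h_1$ only if $i<j$; for $i\ge 2$, the adjacent predecessor of $h_i$ is its parent in $T$. For a perfect matching $M$ of $G$ and adjacent hexagons $h,h'$, the link from $h$ to $h'$ is the pair of edges of $h$ having exactly one end vertex in $h'$; $M$ contains the link if both these edges lie in $M$. The labeling $\ell$ maps each perfect matching $M$ to a binary string in $\{0,1\}^n$: $(\ell(M))_1=1$ iff $e\in M$, where $e$ is the edge of $h_1$ opposite the common edge of $h_1$ and $h_2$; for $i=2,\dots,n$, $(\ell(M))_i=1$ iff $M$ contains the link from $h_i$ to its adjacent predecessor. $\mathcal{L}(G)$ is the set of all labels $\ell(M)$, partially ordered by $u\le v$ iff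 $u_i\le v_i$ for all $i$. For a perfect matching $M$, a hexagon is $M$-alternating if its edges alternate in and out of $M$. A resonant set is a set $S$ of pairwise disjoint hexagons such that some perfect matching $M$ makes every hexagon of $S$ $M$-alternating; it is maximal if not properly contained in another resonant set. The binary representation $b(S)\in\{0,1\}^n$ has $(b(S))_j=1$ iff $h_j\in S$. -}

module Defs where

open import Data.Nat using (ℕ; suc)
open import Data.Fin using (Fin; zero; suc; _<_)
open import Data.Bool using (Bool; true; false) renaming (_≤_ to _≤ᵇ_)
open import Data.Product using (Σ; ∃; ∃-syntax; _×_; _,_)
open import Data.Sum using (_⊎_)
open import Relation.Nullary using (¬_)
open import Relation.Binary.PropositionalEquality using (_≡_; _≢_)

nx : Fin 6 → Fin 6
nx zero = suc zero
nx (suc zero) = suc (suc zero)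
nx (suc (suc zero)) = suc (suc (suc zero))
nx (suc (suc (suc zero))) = suc (suc (suc (suc zero)))
nx (suc (suc (suc (suc zero)))) = suc (suc (suc (suc (suc zero))))
nx (suc (suc (suc (suc (suc zero))))) = zero

-- the edge (k+3, k+4) is opposite to the edge (k, k+1)
opp : Fin 6 → Fin 6
opp k = nx (nx (nx k))

-- Raw hexagon data: N hexagons on the vertex set Fin V, hexagon i being
-- the 6-cycle  hex i 0 - hex i 1 - ... - hex i 5 - hex i 0.

module Hexagons {N V : ℕ} (hex : Fin N → Fin 6 → Fin V) where

  _∈H_ : Fin V → Fin N → Set
  v ∈H i = ∃[ k ] hex i k ≡ v

  HexEdge : Fin N → Fin V → Fin V → Set
  HexEdge i u v = ∃[ k ] ((hex i k ≡ u × hex i (nx k) ≡ v) ⊎ (hex i k ≡ v × hex i (nx k) ≡ u))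

  Edge : Fin V → Fin V → Set
  Edge u v = ∃[ i ] HexEdge i u v

  Adj : Fin N → Fin N → Set
  Adj i j = i ≢ j × ∃[ u ] ∃[ v ] (HexEdge i u v × HexEdge j u v)

  Deg2 : Fin V → Set
  Deg2 v = ∃[ a ] ∃[ b ] (a ≢ b × Edge v a × Edge v b × (∀ w → Edge v w → w ≡ a ⊎ w ≡ b))

  TwoNeighbours : Fin N → Set
  TwoNeighbours i = ∃[ j₁ ] ∃[ j₂ ] (j₁ ≢ j₂ × Adj i j₁ × Adj i j₂ × (∀ j → Adj i j → j ≡ j₁ ⊎ j ≡ j₂))

  LinearlyConnected : Fin N → Set
  LinearlyConnected i = TwoNeighbours i ×
    (∀ k k' → k ≢ k' → Deg2 (hex i k) → Deg2 (hex i k') → ¬ Edge (hex i k) (hex i k'))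

  GoodIntersection : Fin N → Fin N → Set
  GoodIntersection i j =
    (∀ k → ¬ (hex i k ∈H j)) ⊎
    (∃[ k ] (HexEdge j (hex i k) (hex i (nx k)) ×
             (∀ k' → hex i k' ∈H j → k' ≡ k ⊎ k' ≡ nx k)))

-- A catacondensed benzenoid system with N hexagons.
-- (2-connected plane graph, interior faces = the hexagons; for the
--  catacondensed case this is a tree-like gluing of hexagons along
--  edges.)

record Catacondensed (N V : ℕ) : Set where
  field
    hex        : Fin N → Fin 6 → Fin V
    hex-inj    : ∀ i k k' → hex i k ≡ hex i k' → k ≡ k'
  open Hexagons hex public
  field
    cover      : ∀ v → ∃[ i ] v ∈H i
    intersect  : ∀ i j → i ≢ j → GoodIntersection i j
    cata       : ∀ v i j k → v ∈H i → v ∈H j → v ∈H k → i ≡ j ⊎ i ≡ k ⊎ j ≡ k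

Kinky : ∀ {N V} → Catacondensed N V → Set
Kinky G = ∀ i → ¬ Catacondensed.LinearlyConnected G i

-- Numbering h₁,…,hₙ (here indices 0,…,n-1, n = suc (suc m)) of the
-- hexagons: the inner dual T is a tree rooted at the leaf h₁ (= index 0),
-- with every predecessor of a hexagon having a smaller index.  par i is the
-- parent (adjacent predecessor) of i in T.

record Numbering {m V : ℕ} (G : Catacondensed (suc (suc m)) V) : Set where
  open Catacondensed G
  field
    par      : Fin (suc (suc m)) → Fin (suc (suc m))
    par-lt   : ∀ i → i ≢ zero → par i < i
    par-adj  : ∀ i → i ≢ zero → Adj (par i) i
    -- the only neighbour of i with smaller index is its parent (T is a tree
    -- and predecessors have smaller indices)
    par-uniq : ∀ i j → j < i → Adj j i → j ≡ par i
    leaf     : ∀ j → Adj zero j → j ≡ suc zero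

record PerfectMatching {N V : ℕ} (G : Catacondensed N V) : Set where
  open Catacondensed G
  field
    mate      : Fin V → Fin V
    mate-inv  : ∀ v → mate (mate v) ≡ v
    mate-edge : ∀ v → Edge v (mate v)

module _ {N V : ℕ} {G : Catacondensed N V} where
  open Catacondensed G
  open PerfectMatching

  InM : PerfectMatching G → Fin V → Fin V → Set
  InM M u v = mate M u ≡ v

  Alternating : PerfectMatching G → Fin N → Set
  Alternating M i =
    (∀ k → k ≡ zero ⊎ k ≡ nx (nx zero) ⊎ k ≡ nx (nx (nx (nx zero))) → InM M (hex i k) (hex i (nx k))) ⊎
    (∀ k → k ≡ nx zero ⊎ k ≡ nx (nx (nx zero)) ⊎ k ≡ nx (nx (nx (nx (nx zero)))) → InM M (hex i k) (hex i (nx k)))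

  ContainsLink : PerfectMatching G → Fin N → Fin N → Set
  ContainsLink M h h' = ∀ k →
    ((hex h k ∈H h' × ¬ (hex h (nx k) ∈H h')) ⊎ (¬ (hex h k ∈H h') × hex h (nx k) ∈H h')) →
    InM M (hex h k) (hex h (nx k))

  -- subsets of hexagons as binary strings (b(S))
  Disjoint : Fin N → Fin N → Set
  Disjoint i j = ∀ k l → hex i k ≢ hex j l

  Resonant : (Fin N → Bool) → Set
  Resonant S = (∀ i j → i ≢ j → S i ≡ true → S j ≡ true → Disjoint i j) ×
               (∃[ M ] (∀ i → S i ≡ true → Alternating M i))

  _⊆S_ : (Fin N → Bool) → (Fin N → Bool) → Set
  S ⊆S S' = ∀ i → S i ≤ᵇ S' i

  MaximalResonant : (Fin N → Bool) → Set
  MaximalResonant S = Resonant S ×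
    (∀ S' → Resonant S' → S ⊆S S' → ∀ i → S' i ≡ S i)

-- The labeling ℓ : w is ℓ(M) (w_i = 1 iff the defining condition holds).
module _ {m V : ℕ} {G : Catacondensed (suc (suc m)) V} (T : Numbering G) where
  open Catacondensed G
  open Numbering T

  LabelCond : PerfectMatching G → Fin (suc (suc m)) → Set
  LabelCond M zero = ∃[ k ] (HexEdge (suc zero) (hex zero k) (hex zero (nx k)) ×
                             InM M (hex zero (opp k)) (hex zero (nx (opp k))))
  LabelCond M (suc i) = ContainsLink M (suc i) (par (suc i))

  IsLabel : PerfectMatching G → (Fin (suc (suc m)) → Bool) → Set
  IsLabel M w = ∀ i → (w i ≡ true → LabelCond M i) × (LabelCond M i → w i ≡ true)

  InL : (Fin (suc (suc m)) → Bool) → Set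
  InL w = ∃[ M ] IsLabel M w

  MaximalInL : (Fin (suc (suc m)) → Bool) → Set
  MaximalInL w = InL w × (∀ w' → InL w' → (∀ i → w i ≤ᵇ w' i) → ∀ i → w' i ≡ w i)

-- A hexagon hᵢ (i ≥ 2) labelled 1 contains the link to its parent, two of its
-- edges; the opposite edge is forced by walking around the hexagon. The walk
-- rests on an invariant proved from the leaves of T up: the two vertices a
-- hexagon shares with its parent are matched into the parent together or not
-- at all. The walk can only be diverted by a child glued along the edge
-- opposite the parent, and such a child would make hᵢ linearly connected. For
-- h₁, a leaf, the opposite edge forces the rest. Two labelled hexagons cannot
-- meet, since a labelled child matches a vertex of its alternating parent out
-- of the parent; so ℓ(M) is resonant. Conversely, a resonant set S is realised
-- by a matching using, on every hexagon of S, the perfect matching of that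
-- hexagon containing its link to the parent; its label contains S, and
-- maximality of ℓ(M) gives S = ℓ(M).
module Submission where

open import Defs
open import Data.Nat using (ℕ; suc; s≤s)
open import Data.Nat.GeneralisedArithmetic using (iterate)
open import Data.Nat.Properties using (n≮0)
open import Data.Bool using (Bool; true; false; not; _xor_) renaming (_≤_ to _≤ᵇ_)
open import Data.Bool.Properties using (≤-minimum; ≤-reflexive; ≤-trans; ≤-antisym) renaming (_≟_ to _≟ᵇ_)
open import Data.Fin using (Fin; suc; toℕ; _<_)
open import Data.Fin.Patterns using (0F; 1F; 2F; 3F; 4F; 5F)
open import Data.Fin.Properties using (all?; any?; _≟_; <-cmp; <⇒≢; <-asym)
open import Data.Fin.Induction using (>-wellFounded)
open import Induction.WellFounded using (module All)
open import Data.Product using (∃; ∃-syntax; _×_; _,_; proj₁; proj₂)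
open import Data.Sum using (_⊎_; inj₁; inj₂; swap)
open import Data.Empty using (⊥; ⊥-elim)
open import Data.Unit using (⊤)
open import Function using (_∘_; id)
open import Level using (0ℓ)
open import Relation.Nullary using (¬_; Dec; yes; no; does)
open import Relation.Nullary.Decidable using (from-yes; dec-true; decidable-stable; _×-dec_; _⊎-dec_; _→-dec_; ¬?)
open import Relation.Binary.PropositionalEquality using (_≡_; _≢_; refl; sym; trans; cong; subst)
open import Relation.Binary.Definitions using (tri<; tri≈; tri>)

does⇒ : ∀ {A : Set} (a? : Dec A) → does a? ≡ true → A
does⇒ (yes a) _ = a

¬three-in-two : ∀ {A : Set} {x y z s s′ : A} → x ≢ y → x ≢ z → y ≢ z →
  x ≡ s ⊎ x ≡ s′ → y ≡ s ⊎ y ≡ s′ → z ≡ s ⊎ z ≡ s′ → ⊥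
¬three-in-two x≢y _ _ (inj₁ refl) (inj₁ refl) _ = x≢y refl
¬three-in-two x≢y _ _ (inj₂ refl) (inj₂ refl) _ = x≢y refl
¬three-in-two _ x≢z _ (inj₁ refl) _ (inj₁ refl) = x≢z refl
¬three-in-two _ x≢z _ (inj₂ refl) _ (inj₂ refl) = x≢z refl
¬three-in-two _ _ y≢z (inj₁ refl) (inj₂ refl) (inj₂ refl) = y≢z refl
¬three-in-two _ _ y≢z (inj₂ refl) (inj₁ refl) (inj₁ refl) = y≢z refl

prev : Fin 6 → Fin 6
prev 0F = 5F
prev 1F = 0F
prev 2F = 1F
prev 3F = 2F
prev 4F = 3F
prev 5F = 4F

step : Bool → Fin 6 → Fin 6
step true  = nx
step false = prev

orient : ∀ {P : Fin 6 → Set} b {t} → P (nx t) ⊎ P (prev t) → P (step b t) ⊎ P (step (not b) t)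
orient true  = id
orient false = swap

rot : Fin 6 → Fin 6 → Fin 6
rot a t = iterate nx t (toℕ a)

isOdd : Fin 6 → Bool
isOdd 0F = false
isOdd 1F = true
isOdd 2F = false
isOdd 3F = true
isOdd 4F = false
isOdd 5F = true

-- The position matched to k by the perfect matching of a hexagon that avoids
-- its edge {a, a+1}.
partner : Fin 6 → Fin 6 → Fin 6
partner a k = step (isOdd a xor isOdd k) k

prev-nx : ∀ t → prev (nx t) ≡ t
prev-nx = from-yes (all? λ t → prev (nx t) ≟ t)

nx-prev : ∀ t → nx (prev t) ≡ t
nx-prev = from-yes (all? λ t → nx (prev t) ≟ t)

nx⇒prev : ∀ {t s} → nx t ≡ s → t ≡ prev s
nx⇒prev {t} e = trans (sym (prev-nx t)) (cong prev e)

nx≢prev : ∀ t → nx t ≢ prev t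
nx≢prev = from-yes (all? λ t → ¬? (nx t ≟ prev t))

step-inverse : ∀ b t → step (not b) (step b t) ≡ t
step-inverse true  = prev-nx
step-inverse false = nx-prev

step≢ : ∀ b t → step b t ≢ t
step≢ true  = from-yes (all? λ t → ¬? (nx t ≟ t))
step≢ false = from-yes (all? λ t → ¬? (prev t ≟ t))

step≢step-not : ∀ b t → step b t ≢ step (not b) t
step≢step-not true  t = nx≢prev t
step≢step-not false t = nx≢prev t ∘ sym

rot-0 : ∀ a → rot a 0F ≡ a
rot-0 = from-yes (all? λ a → rot a 0F ≟ a)

rot-nx : ∀ a t → rot a (nx t) ≡ nx (rot a t)
rot-nx = from-yes (all? λ a → all? λ t → rot a (nx t) ≟ nx (rot a t))

rot-opp : ∀ a t → opp (rot a t) ≡ rot a (opp t)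
rot-opp = from-yes (all? λ a → all? λ t → opp (rot a t) ≟ rot a (opp t))

rot-injective : ∀ a {s t} → rot a s ≡ rot a t → s ≡ t
rot-injective a {s} {t} = from-yes (all? λ a → all? λ s → all? λ t → (rot a s ≟ rot a t) →-dec (s ≟ t)) a s t

rot-surjective : ∀ a k → ∃ λ t → rot a t ≡ k
rot-surjective = from-yes (all? λ a → all? λ k → any? λ t → rot a t ≟ k)

partner-involutive : ∀ a k → partner a (partner a k) ≡ k
partner-involutive = from-yes (all? λ a → all? λ k → partner a (partner a k) ≟ k)

partner-rot : ∀ a t → partner a (rot a t) ≡ rot a (partner 0F t)
partner-rot = from-yes (all? λ a → all? λ t → partner a (rot a t) ≟ rot a (partner 0F t))

partner-opp : ∀ a → partner a (opp (rot a 0F)) ≡ nx (opp (rot a 0F))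
partner-opp = from-yes (all? λ a → partner a (opp (rot a 0F)) ≟ nx (opp (rot a 0F)))

OffAnchor : Fin 6 → Set
OffAnchor 0F = ⊥
OffAnchor 1F = ⊥
OffAnchor _  = ⊤

Even Odd : Fin 6 → Set
Even k = k ≡ 0F ⊎ k ≡ 2F ⊎ k ≡ 4F
Odd k = k ≡ 1F ⊎ k ≡ 3F ⊎ k ≡ 5F

even? : ∀ k → Dec (Even k)
even? k = k ≟ 0F ⊎-dec k ≟ 2F ⊎-dec k ≟ 4F

odd? : ∀ k → Dec (Odd k)
odd? k = k ≟ 1F ⊎-dec k ≟ 3F ⊎-dec k ≟ 5F

even-or-prev : ∀ k → Even k ⊎ Even (prev k)
even-or-prev = from-yes (all? λ k → even? k ⊎-dec even? (prev k))

odd-or-prev : ∀ k → Odd k ⊎ Odd (prev k)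
odd-or-prev = from-yes (all? λ k → odd? k ⊎-dec odd? (prev k))

partner-alternates : ∀ a → (∀ k → Even k → partner a k ≡ nx k) ⊎ (∀ k → Odd k → partner a k ≡ nx k)
partner-alternates = from-yes (all? λ a →
  all? (λ k → even? k →-dec (partner a k ≟ nx k)) ⊎-dec all? (λ k → odd? k →-dec (partner a k ≟ nx k)))

module Geometry {N V : ℕ} (G : Catacondensed N V) where
  open Catacondensed G

  _∈H?_ : ∀ v i → Dec (v ∈H i)
  v ∈H? i = any? λ k → hex i k ≟ v

  HexEdge? : ∀ i u v → Dec (HexEdge i u v)
  HexEdge? i u v = any? λ k →
    ((hex i k ≟ u) ×-dec (hex i (nx k) ≟ v)) ⊎-dec ((hex i k ≟ v) ×-dec (hex i (nx k) ≟ u))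

  hexEdge⇒∈ˡ : ∀ {i u v} → HexEdge i u v → u ∈H i
  hexEdge⇒∈ˡ (k , inj₁ (p , _)) = k , p
  hexEdge⇒∈ˡ (k , inj₂ (_ , q)) = nx k , q

  hexEdge⇒∈ʳ : ∀ {i u v} → HexEdge i u v → v ∈H i
  hexEdge⇒∈ʳ (k , inj₁ (_ , q)) = nx k , q
  hexEdge⇒∈ʳ (k , inj₂ (p , _)) = k , p

  hexEdge⇒≢ : ∀ {i u v} → HexEdge i u v → u ≢ v
  hexEdge⇒≢ {i} (k , inj₁ (p , q)) u≡v = step≢ true k (hex-inj i _ _ (trans q (trans (sym u≡v) (sym p))))
  hexEdge⇒≢ {i} (k , inj₂ (p , q)) u≡v = step≢ true k (hex-inj i _ _ (trans q (trans u≡v (sym p))))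

  hexEdge-step : ∀ i k b → HexEdge i (hex i k) (hex i (step b k))
  hexEdge-step i k true  = k , inj₁ (refl , refl)
  hexEdge-step i k false = prev k , inj₂ (refl , cong (hex i) (nx-prev k))

  Adj-sym : ∀ {i g} → Adj i g → Adj g i
  Adj-sym (i≢g , u , v , eᵢ , e_g) = i≢g ∘ sym , u , v , e_g , eᵢ

  shared-vertex-unique : ∀ {v i g h} → v ∈H i → v ∈H g → v ∈H h → i ≢ g → i ≢ h → g ≡ h
  shared-vertex-unique v∈i v∈g v∈h i≢g i≢h with cata _ _ _ _ v∈i v∈g v∈h
  ... | inj₁ i≡g        = ⊥-elim (i≢g i≡g)
  ... | inj₂ (inj₁ i≡h) = ⊥-elim (i≢h i≡h)
  ... | inj₂ (inj₂ g≡h) = g≡h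

  corner : Fin N → Fin 6 → Fin 6 → Fin V
  corner i a t = hex i (rot a t)

  corner-injective : ∀ i a {s t} → corner i a s ≡ corner i a t → s ≡ t
  corner-injective i a e = rot-injective a (hex-inj i _ _ e)

  corner-distinct : ∀ i a {s t} → s ≢ t → corner i a s ≢ corner i a t
  corner-distinct i a s≢t = s≢t ∘ corner-injective i a

  corner-nx : ∀ i a t → hex i (nx (rot a t)) ≡ corner i a (nx t)
  corner-nx i a t = cong (hex i) (sym (rot-nx a t))

  corner-surjective : ∀ i a {v} → v ∈H i → ∃ λ t → corner i a t ≡ v
  corner-surjective i a (k , refl) with rot-surjective a k
  ... | t , refl = t , refl

  Attached : Fin N → Fin 6 → Fin N → Fin 6 → Set
  Attached i a g s = HexEdge g (corner i a s) (corner i a (nx s)) ×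
                     (∀ t → corner i a t ∈H g → t ≡ s ⊎ t ≡ nx s)

  reframe : ∀ {i g} a s → Attached i 0F g (rot a s) → Attached i a g s
  reframe {i} a s (e , only) =
    subst (HexEdge _ (corner i a s)) (corner-nx i a s) e , λ t → positions ∘ only (rot a t)
    where
    positions : ∀ {t} → rot a t ≡ rot a s ⊎ rot a t ≡ nx (rot a s) → t ≡ s ⊎ t ≡ nx s
    positions (inj₁ e) = inj₁ (rot-injective a e)
    positions (inj₂ e) = inj₂ (rot-injective a (trans e (sym (rot-nx a s))))

  attached : ∀ {i g k} → i ≢ g → hex i k ∈H g → ∀ a → ∃ (Attached i a g)
  attached {i} {g} {k} i≢g k∈g a with intersect i g i≢g
  ... | inj₁ apart = ⊥-elim (apart k k∈g)
  ... | inj₂ (k₀ , glued) with rot-surjective a k₀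
  ...   | s , refl = s , reframe a s glued

  meet⇒Adj : ∀ {i g k} → i ≢ g → hex i k ∈H g → Adj i g
  meet⇒Adj {i} i≢g k∈g with attached i≢g k∈g 0F
  ... | s , e , _ = i≢g , _ , _ , hexEdge-step i s true , e

  Adj⇒attached : ∀ {i g} → Adj i g → ∀ a → ∃ (Attached i a g)
  Adj⇒attached (i≢g , _ , _ , eᵢ , e_g) a with hexEdge⇒∈ˡ eᵢ
  ... | k , refl = attached i≢g (hexEdge⇒∈ˡ e_g) a

  Adj⇒framed : ∀ {i g} → Adj i g → ∃ λ a → Attached i a g 0F
  Adj⇒framed {i} {g} adj with Adj⇒attached adj 0F
  ... | k , glued = k , reframe k 0F (subst (Attached i 0F g) (sym (rot-0 k)) glued)

  inner-neighbour : ∀ i a {s t} → Edge (corner i a s) (corner i a t) → t ≡ nx s ⊎ t ≡ prev s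
  inner-neighbour i a {s} {t} (g , e) with g ≟ i
  ... | yes refl = own e
    where
    own : HexEdge i (corner i a s) (corner i a t) → t ≡ nx s ⊎ t ≡ prev s
    own (k , inj₁ (p , q)) with hex-inj i _ _ p
    ... | refl = inj₁ (rot-injective a (trans (hex-inj i _ _ (sym q)) (sym (rot-nx a s))))
    own (k , inj₂ (p , q)) with hex-inj i _ _ p
    ... | refl = inj₂ (nx⇒prev (rot-injective a (trans (rot-nx a t) (hex-inj i _ _ q))))
  ... | no g≢i with attached (g≢i ∘ sym) (hexEdge⇒∈ˡ e) a
  ...   | r , _ , only with only s (hexEdge⇒∈ˡ e) | only t (hexEdge⇒∈ʳ e)
  ...     | inj₁ refl | inj₁ refl = ⊥-elim (hexEdge⇒≢ e refl)
  ...     | inj₂ refl | inj₂ refl = ⊥-elim (hexEdge⇒≢ e refl)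
  ...     | inj₁ refl | inj₂ refl = inj₁ refl
  ...     | inj₂ refl | inj₁ refl = inj₂ (sym (prev-nx t))

  outer-neighbour : ∀ {i g v} → g ≢ i → v ∈H g → v ∈H i → ∃ λ z → Edge v z × ¬ z ∈H i
  outer-neighbour {i} {g} g≢i (l , refl) l∈i with attached g≢i l∈i 0F
  ... | _ , _ , only with hex g (nx l) ∈H? i | hex g (prev l) ∈H? i
  ...   | no ∉i | _     = _ , (g , hexEdge-step g l true) , ∉i
  ...   | yes _ | no ∉i = _ , (g , hexEdge-step g l false) , ∉i
  ...   | yes n∈i | yes p∈i =
    ⊥-elim (¬three-in-two (step≢ true l ∘ sym) (step≢ false l ∘ sym) (nx≢prev l)
                          (only l l∈i) (only (nx l) n∈i) (only (prev l) p∈i))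

  shared⇒¬Deg2 : ∀ {i g} k → g ≢ i → hex i k ∈H g → ¬ Deg2 (hex i k)
  shared⇒¬Deg2 {i} k g≢i k∈g (_ , _ , _ , _ , _ , two) with outer-neighbour g≢i k∈g (k , refl)
  ... | z , e-z , z∉i =
    ¬three-in-two (λ n≡p → nx≢prev k (hex-inj i _ _ n≡p))
                  (λ n≡z → z∉i (nx k , n≡z)) (λ p≡z → z∉i (prev k , p≡z))
                  (two _ (i , hexEdge-step i k true)) (two _ (i , hexEdge-step i k false)) (two _ e-z)

  module Matching (M : PerfectMatching G) where
    open PerfectMatching M

    mate-sym : ∀ {u v} → mate u ≡ v → mate v ≡ u
    mate-sym {u} refl = mate-inv u

    mate-inner : ∀ i a t → mate (corner i a t) ∈H i →
                 mate (corner i a t) ≡ corner i a (nx t) ⊎ mate (corner i a t) ≡ corner i a (prev t)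
    mate-inner i a t m∈i with corner-surjective i a m∈i
    ... | t′ , e with inner-neighbour i a (subst (Edge (corner i a t)) (sym e) (mate-edge (corner i a t)))
    ...   | inj₁ refl = inj₁ (sym e)
    ...   | inj₂ refl = inj₂ (sym e)

    mate∈-private : ∀ {v i} → (∀ g → v ∈H g → g ≡ i) → mate v ∈H i
    mate∈-private {v} only with mate-edge v
    ... | g , e with only g (hexEdge⇒∈ˡ e)
    ...   | refl = hexEdge⇒∈ʳ e

    Kekule : Fin N → Fin 6 → Set
    Kekule i a = ∀ k → mate (hex i k) ≡ hex i (partner a k)

    kekule-corner : ∀ i a → Kekule i a → ∀ t → mate (corner i a t) ≡ corner i a (partner 0F t)
    kekule-corner i a K t = trans (K (rot a t)) (cong (hex i) (partner-rot a t))

    kekule-from-corners : ∀ i a →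
      mate (corner i a 1F) ≡ corner i a 2F → mate (corner i a 3F) ≡ corner i a 4F →
      mate (corner i a 5F) ≡ corner i a 0F → Kekule i a
    kekule-from-corners i a e12 e34 e50 k with rot-surjective a k
    ... | t , refl = trans (corners t) (cong (hex i) (sym (partner-rot a t)))
      where
      corners : ∀ t → mate (corner i a t) ≡ corner i a (partner 0F t)
      corners 0F = mate-sym e50
      corners 1F = e12
      corners 2F = mate-sym e12
      corners 3F = e34
      corners 4F = mate-sym e34
      corners 5F = e50

    Kekule⇒Alternating : ∀ {i a} → Kekule i a → Alternating M i
    Kekule⇒Alternating {i} {a} K with partner-alternates a
    ... | inj₁ evens = inj₁ λ k k∈ → trans (K k) (cong (hex i) (evens k k∈))
    ... | inj₂ odds  = inj₂ λ k k∈ → trans (K k) (cong (hex i) (odds k k∈))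

    Kekule⇒mate∈ : ∀ {i a} → Kekule i a → ∀ {v} → v ∈H i → mate v ∈H i
    Kekule⇒mate∈ {a = a} K (k , refl) = partner a k , sym (K k)

    edges⇒mate∈ : ∀ {i} (E : Fin 6 → Set) → (∀ k → E k ⊎ E (prev k)) →
                  (∀ k → E k → mate (hex i k) ≡ hex i (nx k)) → ∀ {v} → v ∈H i → mate v ∈H i
    edges⇒mate∈ E cover forward (k , refl) with cover k
    ... | inj₁ e = nx k , sym (forward k e)
    ... | inj₂ e = prev k , sym (mate-sym (trans (forward (prev k) e) (cong (hex _) (nx-prev k))))

    Alternating⇒mate∈ : ∀ {i} → Alternating M i → ∀ {v} → v ∈H i → mate v ∈H i
    Alternating⇒mate∈ (inj₁ forward) = edges⇒mate∈ Even even-or-prev forward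
    Alternating⇒mate∈ (inj₂ forward) = edges⇒mate∈ Odd odd-or-prev forward

  -- Away from S the matching is unchanged: the hexagons of S are disjoint and
  -- closed under the old matching, being alternating.
  rematch : ∀ {S} → Resonant {G = G} S → (a : Fin N → Fin 6) →
            ∃[ M ] (∀ i → S i ≡ true → Matching.Kekule M i (a i))
  rematch {S} (disjoint , M , alternating) a = M′ , kekule
    where
    open PerfectMatching M

    OnS : Fin V → Set
    OnS v = ∃ λ i → S i ≡ true × v ∈H i

    OnS? : ∀ v → Dec (OnS v)
    OnS? v = any? λ i → (S i ≟ᵇ true) ×-dec (v ∈H? i)

    redirect : ∀ v → Dec (OnS v) → Fin V
    redirect _ (yes (i , _ , k , _)) = hex i (partner (a i) k)
    redirect v (no _)                = mate v

    redirect-on : ∀ {i} k → S i ≡ true → (d : Dec (OnS (hex i k))) →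
                  redirect (hex i k) d ≡ hex i (partner (a i) k)
    redirect-on {i} k i∈S (yes (i′ , i′∈S , k′ , e)) with i′ ≟ i
    ... | no i′≢i = ⊥-elim (disjoint i′ i i′≢i i′∈S i∈S k′ k e)
    ... | yes refl with hex-inj i k′ k e
    ...   | refl = refl
    redirect-on k i∈S (no off) = ⊥-elim (off (_ , i∈S , k , refl))

    redirect-off : ∀ {v} → ¬ OnS v → (d : Dec (OnS v)) → redirect v d ≡ mate v
    redirect-off off (yes on) = ⊥-elim (off on)
    redirect-off off (no _)   = refl

    off-mate : ∀ {v} → ¬ OnS v → ¬ OnS (mate v)
    off-mate {v} off (i , i∈S , m∈i) =
      off (i , i∈S , subst (_∈H i) (mate-inv v) (Matching.Alternating⇒mate∈ M (alternating i i∈S) m∈i))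

    mate′ : Fin V → Fin V
    mate′ v = redirect v (OnS? v)

    involutive : ∀ v (d : Dec (OnS v)) → mate′ (redirect v d) ≡ v
    involutive _ (yes (i , i∈S , k , refl)) =
      trans (redirect-on (partner (a i) k) i∈S (OnS? _)) (cong (hex i) (partner-involutive (a i) k))
    involutive v (no off) = trans (redirect-off (off-mate off) (OnS? _)) (mate-inv v)

    edge : ∀ v (d : Dec (OnS v)) → Edge v (redirect v d)
    edge _ (yes (i , _ , k , refl)) = i , hexEdge-step i k (isOdd (a i) xor isOdd k)
    edge v (no _)                   = mate-edge v

    M′ : PerfectMatching G
    M′ = record { mate      = mate′
                ; mate-inv  = λ v → involutive v (OnS? v)
                ; mate-edge = λ v → edge v (OnS? v) }

    kekule : ∀ i → S i ≡ true → Matching.Kekule M′ i (a i)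
    kekule i i∈S k = redirect-on k i∈S (OnS? (hex i k))

module Labelling {m V : ℕ} (G : Catacondensed (suc (suc m)) V) (T : Numbering G) where
  open Catacondensed G
  open Numbering T
  open Geometry G

  par≢ : ∀ {i} → i ≢ 0F → par i ≢ i
  par≢ i≢0 = <⇒≢ (par-lt _ i≢0)

  child≢ : ∀ {i g} → par g ≡ i → g ≢ 0F → i ≢ g
  child≢ pg g≢0 i≡g = par≢ g≢0 (trans pg i≡g)

  ¬par-cycle : ∀ {i g} → i ≢ 0F → g ≢ 0F → par i ≡ g → par g ≡ i → ⊥
  ¬par-cycle {i} {g} i≢0 g≢0 pi pg = <-asym (subst (_< i) pi (par-lt i i≢0)) (subst (_< g) pg (par-lt g g≢0))

  Adj⇒parent : ∀ {i g} → Adj i g → (par i ≡ g × i ≢ 0F) ⊎ (par g ≡ i × g ≢ 0F)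
  Adj⇒parent {i} {g} adj with <-cmp i g
  ... | tri< i<g _ _ = inj₂ (sym (par-uniq g i i<g adj) , λ { refl → n≮0 i<g })
  ... | tri≈ _ i≡g _ = ⊥-elim (proj₁ adj i≡g)
  ... | tri> _ _ g<i = inj₁ (sym (par-uniq i g g<i (Adj-sym adj)) , λ { refl → n≮0 g<i })

  par-1 : par 1F ≡ 0F
  par-1 with par 1F | par-lt 1F (λ ())
  ... | 0F    | _       = refl
  ... | suc _ | s≤s ()

  anchor : Fin (suc (suc m)) → Fin (suc (suc m))
  anchor 0F      = 1F
  anchor (suc i) = par (suc i)

  Adj-anchor : ∀ i → Adj i (anchor i)
  Adj-anchor 0F      = subst (λ h → Adj h 1F) par-1 (par-adj 1F (λ ()))
  Adj-anchor (suc i) = Adj-sym (par-adj (suc i) (λ ()))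

  opaque
    anchorPos : Fin (suc (suc m)) → Fin 6
    anchorPos i = proj₁ (Adj⇒framed (Adj-anchor i))

    anchored : ∀ i → Attached i (anchorPos i) (anchor i) 0F
    anchored i = proj₂ (Adj⇒framed (Adj-anchor i))

  module Frame (i : Fin (suc (suc m))) where
    a : Fin 6
    a = anchorPos i

    q : Fin (suc (suc m))
    q = anchor i

    c : Fin 6 → Fin V
    c = corner i a

    c∈i : ∀ t → c t ∈H i
    c∈i t = rot a t , refl

    c0∈q : c 0F ∈H q
    c0∈q = hexEdge⇒∈ˡ (proj₁ (anchored i))

    c1∈q : c 1F ∈H q
    c1∈q = hexEdge⇒∈ʳ (proj₁ (anchored i))

    c∈q⇒ : ∀ {t} → c t ∈H q → t ≡ 0F ⊎ t ≡ 1F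
    c∈q⇒ = proj₂ (anchored i) _

    c∉q : ∀ t {_ : OffAnchor t} → ¬ c t ∈H q
    c∉q t {off} t∈q with c∈q⇒ t∈q
    ... | inj₁ refl = off
    ... | inj₂ refl = off

    LinkEdge : Fin V → Fin V → Set
    LinkEdge u v = (u ∈H q × ¬ v ∈H q) ⊎ (¬ u ∈H q × v ∈H q)

    link-positions : ∀ t → LinkEdge (c t) (c (nx t)) → t ≡ 1F ⊎ t ≡ 5F
    link-positions t (inj₁ (t∈q , nt∉q)) with c∈q⇒ t∈q
    ... | inj₁ refl = ⊥-elim (nt∉q c1∈q)
    ... | inj₂ refl = inj₁ refl
    link-positions t (inj₂ (t∉q , nt∈q)) with c∈q⇒ nt∈q
    ... | inj₁ nt≡0 = inj₂ (nx⇒prev nt≡0)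
    ... | inj₂ nt≡1 = ⊥-elim (t∉q (subst (λ s → c s ∈H q) (sym (nx⇒prev nt≡1)) c0∈q))

    ContainsLink⇒ : ∀ (M : PerfectMatching G) → let open PerfectMatching M in
      ContainsLink M i q → mate (c 1F) ≡ c 2F × mate (c 5F) ≡ c 0F
    ContainsLink⇒ M link = forward 1F (inj₁ (c1∈q , c∉q 2F)) , forward 5F (inj₂ (c∉q 5F , c0∈q))
      where
      forward : ∀ t → LinkEdge (c t) (c (nx t)) → PerfectMatching.mate M (c t) ≡ c (nx t)
      forward t e = trans (link (rot a t) (subst (LinkEdge (c t)) (sym (corner-nx i a t)) e)) (corner-nx i a t)

    ⇒ContainsLink : ∀ (M : PerfectMatching G) → let open PerfectMatching M in
      mate (c 1F) ≡ c 2F → mate (c 5F) ≡ c 0F → ContainsLink M i q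
    ⇒ContainsLink M e12 e50 k link with rot-surjective a k
    ... | t , refl with link-positions t (subst (LinkEdge (c t)) (corner-nx i a t) link)
    ...   | inj₁ refl = trans e12 (sym (corner-nx i a 1F))
    ...   | inj₂ refl = trans e50 (sym (corner-nx i a 5F))

  module Matched (M : PerfectMatching G) where
    open PerfectMatching M
    open Matching M

    -- Parity reason: the branch of T below j has an even number of vertices, and
    -- all but the two on par j have their neighbours inside the branch. The
    -- proof below is local instead, from the leaves up.
    Balanced : Fin (suc (suc m)) → Set
    Balanced j = ∀ {u v} → u ∈H j → u ∈H par j → v ∈H j → v ∈H par j →
                 mate u ∈H par j → mate v ∈H par j

    module Branch (j : Fin (suc m)) (balanced-below : ∀ g → par g ≡ suc j → g ≢ 0F → Balanced g) where
      open Frame (suc j)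

      i : Fin (suc (suc m))
      i = suc j

      In : Fin 6 → Set
      In t = mate (c t) ∈H i

      ChildOn : Fin 6 → Fin 6 → Set
      ChildOn x y = ∃ λ g → par g ≡ i × g ≢ 0F × c x ∈H g × c y ∈H g ×
                            (∀ t → c t ∈H g → t ≡ x ⊎ t ≡ y)

      Closed : Fin 6 → Fin 6 → Set
      Closed x y = mate (c x) ≡ c y ⊎ (ChildOn x y × ¬ In x × ¬ In y)

      i≢q : i ≢ q
      i≢q = par≢ (λ ()) ∘ sym

      ChildOn-sym : ∀ {x y} → ChildOn x y → ChildOn y x
      ChildOn-sym (g , pg , g≢0 , x∈g , y∈g , only) = g , pg , g≢0 , y∈g , x∈g , λ t → swap ∘ only t

      child-balanced : ∀ {x y} → ChildOn x y → In x → In y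
      child-balanced {x} {y} (g , pg , g≢0 , x∈g , y∈g , _) in-x =
        subst (mate (c y) ∈H_) pg (balanced-below g pg g≢0 x∈g (up (c∈i x)) y∈g (up (c∈i y)) (up in-x))
        where
        up : ∀ {v} → v ∈H i → v ∈H par g
        up {v} = subst (v ∈H_) (sym pg)

      children-meet : ∀ {x y z} → ChildOn x y → ChildOn y z → z ≡ x ⊎ z ≡ y
      children-meet {y = y} (g , pg , g≢0 , _ , y∈g , only) (g′ , pg′ , g′≢0 , y∈g′ , z∈g′ , _)
        with shared-vertex-unique (c∈i y) y∈g y∈g′ (child≢ pg g≢0) (child≢ pg′ g′≢0)
      ... | refl = only _ z∈g′

      child-off-parent : ∀ {x y} → ChildOn x y → ¬ c x ∈H q
      child-off-parent {x} (g , pg , g≢0 , x∈g , _) x∈q =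
        ¬par-cycle (λ ()) g≢0 (shared-vertex-unique (c∈i x) x∈q x∈g i≢q (child≢ pg g≢0)) pg

      out⇒child : ∀ {t} → ¬ In t → ¬ c t ∈H q → ChildOn t (nx t) ⊎ ChildOn t (prev t)
      out⇒child {t} out t∉q with mate-edge (c t)
      ... | g , e with g ≟ i
      ...   | yes refl = ⊥-elim (out (hexEdge⇒∈ʳ e))
      ...   | no g≢i with Adj⇒parent (meet⇒Adj (g≢i ∘ sym) (hexEdge⇒∈ˡ e))
      ...     | inj₁ (pi≡g , _) = ⊥-elim (t∉q (subst (c t ∈H_) (sym pi≡g) (hexEdge⇒∈ˡ e)))
      ...     | inj₂ (pg , g≢0) with attached (g≢i ∘ sym) (hexEdge⇒∈ˡ e) a
      ...       | s , e′ , only with only t (hexEdge⇒∈ˡ e)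
      ...         | inj₁ refl = inj₁ (g , pg , g≢0 , hexEdge⇒∈ˡ e′ , hexEdge⇒∈ʳ e′ , only)
      ...         | inj₂ refl = inj₂ (subst (ChildOn (nx s)) (sym (prev-nx s))
                                       (ChildOn-sym (g , pg , g≢0 , hexEdge⇒∈ˡ e′ , hexEdge⇒∈ʳ e′ , only)))

      in-or-into-parent : ∀ {t} → c t ∈H q → In t ⊎ mate (c t) ∈H q
      in-or-into-parent {t} t∈q with mate-edge (c t)
      ... | g , e with g ≟ i
      ...   | yes refl = inj₁ (hexEdge⇒∈ʳ e)
      ...   | no g≢i with shared-vertex-unique (c∈i t) t∈q (hexEdge⇒∈ˡ e) i≢q (g≢i ∘ sym)
      ...     | refl = inj₂ (hexEdge⇒∈ʳ e)

      closed-taken : ∀ {x y z} → Closed x y → mate (c z) ≡ c y → z ≡ x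
      closed-taken (inj₁ xy) zy = corner-injective i a (trans (sym (mate-sym zy)) (mate-sym xy))
      closed-taken {z = z} (inj₂ (_ , _ , out-y)) zy =
        ⊥-elim (out-y (subst (_∈H i) (sym (mate-sym zy)) (c∈i z)))

      closed-child : ∀ {x y z} → Closed x y → ChildOn z y → ¬ In z → z ≡ x ⊎ z ≡ y
      closed-child {x} (inj₁ xy) zy out-z =
        ⊥-elim (out-z (child-balanced (ChildOn-sym zy) (subst (_∈H i) (sym (mate-sym xy)) (c∈i x))))
      closed-child (inj₂ (xy , _)) zy _ = children-meet xy (ChildOn-sym zy)

      -- Walking around i in direction b: once c t is paired off backwards, the
      -- next two corners are paired off with each other.
      closed-step : ∀ b t → ¬ c (step b t) ∈H q → Closed (step (not b) t) t →
                    Closed (step b t) (step b (step b t))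
      closed-step b t t₁∉q closed with mate (c (step b t)) ∈H? i
      ... | yes in₁ with orient {P = λ s → mate (c (step b t)) ≡ c s} b (mate-inner i a (step b t) in₁)
      ...   | inj₁ onward = inj₁ onward
      ...   | inj₂ back = ⊥-elim (step≢step-not b t
                            (closed-taken closed (subst (λ s → mate (c (step b t)) ≡ c s) (step-inverse b t) back)))
      closed-step b t t₁∉q closed | no out₁ with orient {P = ChildOn (step b t)} b (out⇒child out₁ t₁∉q)
      ... | inj₁ child = inj₂ (child , out₁ , out₁ ∘ child-balanced (ChildOn-sym child))
      ... | inj₂ child with closed-child closed (subst (ChildOn (step b t)) (step-inverse b t) child) out₁
      ...   | inj₁ e = ⊥-elim (step≢step-not b t e)
      ...   | inj₂ e = ⊥-elim (step≢ b t e)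

      into-parent-0⇒1 : mate (c 0F) ∈H q → ¬ ¬ mate (c 1F) ∈H q
      into-parent-0⇒1 m0 out with in-or-into-parent c1∈q
      ... | inj₂ into = out into
      ... | inj₁ in₁ with mate-inner i a 1F in₁
      ...   | inj₂ e10 = out (subst (_∈H q) (sym e10) c0∈q)
      ...   | inj₁ e12 with closed-step true 4F (c∉q 5F) (closed-step true 2F (c∉q 3F) (inj₁ e12))
      ...     | inj₁ e50 = c∉q 5F (subst (_∈H q) (mate-sym e50) m0)
      ...     | inj₂ (child , _) = child-off-parent (ChildOn-sym child) c0∈q

      into-parent-1⇒0 : mate (c 1F) ∈H q → ¬ ¬ mate (c 0F) ∈H q
      into-parent-1⇒0 m1 out with in-or-into-parent c0∈q
      ... | inj₂ into = out into
      ... | inj₁ in₀ with mate-inner i a 0F in₀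
      ...   | inj₁ e01 = out (subst (_∈H q) (sym e01) c1∈q)
      ...   | inj₂ e05 with closed-step false 3F (c∉q 2F) (closed-step false 5F (c∉q 4F) (inj₁ e05))
      ...     | inj₁ e21 = c∉q 2F (subst (_∈H q) (mate-sym e21) m1)
      ...     | inj₂ (child , _) = child-off-parent (ChildOn-sym child) c1∈q

      balanced : Balanced i
      balanced u∈i u∈q v∈i v∈q with corner-surjective i a u∈i | corner-surjective i a v∈i
      ... | _ , refl | _ , refl = corners (c∈q⇒ u∈q) (c∈q⇒ v∈q)
        where
        corners : ∀ {s t} → s ≡ 0F ⊎ s ≡ 1F → t ≡ 0F ⊎ t ≡ 1F → mate (c s) ∈H q → mate (c t) ∈H q
        corners (inj₁ refl) (inj₁ refl) = id
        corners (inj₂ refl) (inj₂ refl) = id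
        corners (inj₁ refl) (inj₂ refl) = decidable-stable (mate (c 1F) ∈H? q) ∘ into-parent-0⇒1
        corners (inj₂ refl) (inj₁ refl) = decidable-stable (mate (c 0F) ∈H? q) ∘ into-parent-1⇒0

      child-3-4⇒linear : ChildOn 3F 4F → LinearlyConnected i
      child-3-4⇒linear (g , pg , g≢0 , c3∈g , c4∈g , _) =
        (q , g , q≢g , Adj-anchor i , meet⇒Adj i≢g c3∈g , neighbours) , degree-two-apart
        where
        i≢g : i ≢ g
        i≢g = child≢ pg g≢0
        q≢g : q ≢ g
        q≢g q≡g = ¬par-cycle (λ ()) g≢0 q≡g pg
        neighbours : ∀ h → Adj i h → h ≡ q ⊎ h ≡ g
        neighbours h adj with Adj⇒attached adj a
        ... | s , e , _ = by-corner s (hexEdge⇒∈ˡ e) (hexEdge⇒∈ʳ e)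
          where
          to : ∀ {t g′} → c t ∈H g′ → i ≢ g′ → c t ∈H h → h ≡ g′
          to {t} t∈g′ i≢g′ t∈h = sym (shared-vertex-unique (c∈i t) t∈g′ t∈h i≢g′ (proj₁ adj))
          by-corner : ∀ s → c s ∈H h → c (nx s) ∈H h → h ≡ q ⊎ h ≡ g
          by-corner 0F m _ = inj₁ (to c0∈q i≢q m)
          by-corner 1F m _ = inj₁ (to c1∈q i≢q m)
          by-corner 2F _ m = inj₂ (to c3∈g i≢g m)
          by-corner 3F m _ = inj₂ (to c3∈g i≢g m)
          by-corner 4F m _ = inj₂ (to c4∈g i≢g m)
          by-corner 5F _ m = inj₁ (to c0∈q i≢q m)
        degree-two : ∀ t → Deg2 (c t) → t ≡ 2F ⊎ t ≡ 5F
        degree-two 0F d = ⊥-elim (shared⇒¬Deg2 _ (i≢q ∘ sym) c0∈q d)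
        degree-two 1F d = ⊥-elim (shared⇒¬Deg2 _ (i≢q ∘ sym) c1∈q d)
        degree-two 2F _ = inj₁ refl
        degree-two 3F d = ⊥-elim (shared⇒¬Deg2 _ (i≢g ∘ sym) c3∈g d)
        degree-two 4F d = ⊥-elim (shared⇒¬Deg2 _ (i≢g ∘ sym) c4∈g d)
        degree-two 5F _ = inj₂ refl
        degree-two-apart : ∀ k k′ → k ≢ k′ → Deg2 (hex i k) → Deg2 (hex i k′) → ¬ Edge (hex i k) (hex i k′)
        degree-two-apart k k′ k≢k′ d d′ edge with rot-surjective a k | rot-surjective a k′
        ... | t , refl | t′ , refl with degree-two t d | degree-two t′ d′ | inner-neighbour i a edge
        ...   | inj₁ refl | inj₁ refl | _     = k≢k′ refl
        ...   | inj₂ refl | inj₂ refl | _     = k≢k′ refl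
        ...   | inj₁ refl | inj₂ refl | inj₁ ()
        ...   | inj₁ refl | inj₂ refl | inj₂ ()
        ...   | inj₂ refl | inj₁ refl | inj₁ ()
        ...   | inj₂ refl | inj₁ refl | inj₂ ()

      opposite-matched : Kinky G → mate (c 1F) ≡ c 2F → mate (c 3F) ≡ c 4F
      opposite-matched kinky e12 with closed-step true 2F (c∉q 3F) (inj₁ e12)
      ... | inj₁ e34 = e34
      ... | inj₂ (child , _) = ⊥-elim (kinky i (child-3-4⇒linear child))

    all-balanced : ∀ j → j ≢ 0F → Balanced j
    all-balanced = All.wfRec >-wellFounded 0ℓ (λ j → j ≢ 0F → Balanced j) from-children
      where
      from-children : ∀ j → (∀ {g} → j < g → g ≢ 0F → Balanced g) → j ≢ 0F → Balanced j
      from-children 0F      _     j≢0 = ⊥-elim (j≢0 refl)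
      from-children (suc j) below _   =
        Branch.balanced j λ g pg g≢0 → below (subst (_< g) pg (par-lt g g≢0)) g≢0

    module _ where
      open Frame 0F

      root-private : ∀ t {_ : OffAnchor t} → mate (c t) ∈H 0F
      root-private t {off} = mate∈-private only-root
        where
        only-root : ∀ g → c t ∈H g → g ≡ 0F
        only-root g t∈g with g ≟ 0F
        ... | yes g≡0 = g≡0
        ... | no g≢0 = ⊥-elim (c∉q t {off} (subst (c t ∈H_) (leaf g (meet⇒Adj (g≢0 ∘ sym) t∈g)) t∈g))

      root-kekule : LabelCond T M 0F → Kekule 0F a
      root-kekule (k , k-edge , opp-matched) with rot-surjective a k
      ... | t , refl with c∈q⇒ (hexEdge⇒∈ˡ k-edge)
      ...   | inj₂ refl = ⊥-elim (c∉q 2F (subst (_∈H q) (corner-nx 0F a 1F) (hexEdge⇒∈ʳ k-edge)))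
      ...   | inj₁ refl = kekule-from-corners 0F a e12 e34 e50
        where
        e34 : mate (c 3F) ≡ c 4F
        e34 = trans (subst (λ z → mate (hex 0F z) ≡ hex 0F (nx z)) (rot-opp a 0F) opp-matched)
                    (corner-nx 0F a 3F)
        e12 : mate (c 1F) ≡ c 2F
        e12 with mate-inner 0F a 2F (root-private 2F)
        ... | inj₁ e23 = ⊥-elim (corner-distinct 0F a (λ ()) (trans (sym e34) (mate-sym e23)))
        ... | inj₂ e21 = mate-sym e21
        e50 : mate (c 5F) ≡ c 0F
        e50 with mate-inner 0F a 5F (root-private 5F)
        ... | inj₁ e50 = e50
        ... | inj₂ e54 = ⊥-elim (corner-distinct 0F a (λ ()) (trans (sym (mate-sym e34)) (mate-sym e54)))

    labelled-kekule : Kinky G → ∀ i → LabelCond T M i → Kekule i (anchorPos i)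
    labelled-kekule kinky 0F      label = root-kekule label
    labelled-kekule kinky (suc j) label = kekule-from-corners (suc j) a e12 (opposite-matched kinky e12) e50
      where
      open Frame (suc j)
      open Branch j (λ g _ g≢0 → all-balanced g g≢0) using (opposite-matched)
      e12 : mate (c 1F) ≡ c 2F
      e12 = proj₁ (ContainsLink⇒ M label)
      e50 : mate (c 5F) ≡ c 0F
      e50 = proj₂ (ContainsLink⇒ M label)

    labelled-parent : Kinky G → ∀ {i} → i ≢ 0F → LabelCond T M i → ¬ LabelCond T M (par i)
    labelled-parent kinky {0F}    i≢0 _     _      = i≢0 refl
    labelled-parent kinky {suc j} _   label plabel =
      c∉q 5F (subst (_∈H q) (mate-sym (proj₂ (ContainsLink⇒ M label)))
                                 (Kekule⇒mate∈ {a = anchorPos q} (labelled-kekule kinky q plabel) c0∈q))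
      where open Frame (suc j)

    labelled-disjoint : Kinky G → ∀ {i i′} → i ≢ i′ →
                        LabelCond T M i → LabelCond T M i′ → Disjoint {G = G} i i′
    labelled-disjoint kinky i≢i′ label label′ k l e with Adj⇒parent (meet⇒Adj i≢i′ (l , sym e))
    ... | inj₁ (refl , i≢0)  = labelled-parent kinky i≢0 label label′
    ... | inj₂ (refl , i′≢0) = labelled-parent kinky i′≢0 label′ label

    labelled-resonant : Kinky G → ∀ {w} → IsLabel T M w → Resonant {G = G} w
    labelled-resonant kinky ℓ =
      (λ i i′ i≢i′ wi wi′ → labelled-disjoint kinky i≢i′ (proj₁ (ℓ i) wi) (proj₁ (ℓ i′) wi′)) ,
      M , λ i wi → Kekule⇒Alternating {a = anchorPos i} (labelled-kekule kinky i (proj₁ (ℓ i) wi))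

  LabelCond? : ∀ M i → Dec (LabelCond T M i)
  LabelCond? M 0F = any? λ k →
    HexEdge? 1F (hex 0F k) (hex 0F (nx k)) ×-dec (PerfectMatching.mate M (hex 0F (opp k)) ≟ hex 0F (nx (opp k)))
  LabelCond? M (suc j) = all? λ k →
    (((hex i k ∈H? q) ×-dec ¬? (hex i (nx k) ∈H? q)) ⊎-dec
     (¬? (hex i k ∈H? q) ×-dec (hex i (nx k) ∈H? q)))
      →-dec (PerfectMatching.mate M (hex i k) ≟ hex i (nx k))
    where
    i q : Fin (suc (suc m))
    i = suc j
    q = par i

  labelOf : PerfectMatching G → Fin (suc (suc m)) → Bool
  labelOf M i = does (LabelCond? M i)

  labelOf-isLabel : ∀ M → IsLabel T M (labelOf M)
  labelOf-isLabel M i = does⇒ (LabelCond? M i) , dec-true (LabelCond? M i)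

  kekule⇒LabelCond : ∀ M i → Matching.Kekule M i (anchorPos i) → LabelCond T M i
  kekule⇒LabelCond M 0F K =
    rot a 0F , subst (HexEdge 1F (c 0F)) (sym (corner-nx 0F a 0F)) (proj₁ (anchored 0F)) ,
    trans (K _) (cong (hex 0F) (partner-opp a))
    where open Frame 0F
  kekule⇒LabelCond M (suc j) K =
    Frame.⇒ContainsLink (suc j) M (corners 1F) (corners 5F)
    where
    corners : ∀ t → PerfectMatching.mate M (corner (suc j) (anchorPos (suc j)) t) ≡
                    corner (suc j) (anchorPos (suc j)) (partner 0F t)
    corners = Matching.kekule-corner M (suc j) (anchorPos (suc j)) K

  resonant⊆label : ∀ {S} → Resonant {G = G} S → ∃[ w ] (InL T w × (∀ i → S i ≤ᵇ w i))
  resonant⊆label {S} S-resonant with rematch S-resonant anchorPos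
  ... | M , kekule = labelOf M , (M , labelOf-isLabel M) , S⊆
    where
    S⊆ : ∀ i → S i ≤ᵇ labelOf M i
    S⊆ i with S i in i∈S
    ... | false = ≤-minimum _
    ... | true  = ≤-reflexive (sym (dec-true (LabelCond? M i) (kekule⇒LabelCond M i (kekule i i∈S))))

lemma3 : (m V : ℕ) (G : Catacondensed (suc (suc m)) V) → Kinky G →
    (T : Numbering G) (M : PerfectMatching G) (w : Fin (suc (suc m)) → Bool) →
    IsLabel T M w → MaximalInL T w →
    ∃[ S ] (MaximalResonant {G = G} S × (∀ j → S j ≡ w j))
lemma3 m V G kinky T M w ℓM≡w (_ , w-maximal) = w , (resonant , maximal) , λ _ → refl
  where
  open Labelling G T

  resonant : Resonant {G = G} w
  resonant = Matched.labelled-resonant M kinky ℓM≡w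

  maximal : ∀ S → Resonant {G = G} S → (∀ i → w i ≤ᵇ S i) → ∀ i → S i ≡ w i
  maximal S S-resonant w⊆S i with resonant⊆label S-resonant
  ... | w′ , w′∈L , S⊆w′ = ≤-antisym (subst (S i ≤ᵇ_) (w′≡w i) (S⊆w′ i)) (w⊆S i)
    where
    w′≡w : ∀ i → w′ i ≡ w i
    w′≡w = w-maximal w′ w′∈L (λ j → ≤-trans (w⊆S j) (S⊆w′ j))
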